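{- Let $X=(V,E)$ be a tournament. Then $U_X=U_{\overline{X}}$, and the antipode $S$ of $QSym$ acts on $U_X$ by $S(U_X)=(-1)^{|V|}U_X$.
   Context: A digraph is a pair $X=(V,E)$ with $V$ finite and $E\subset\{(u,v)\in V\times V\mid u\ne v\}$; $n=|V|$. A tournament is a digraph in which for any two distinct vertices $u,v$ exactly one of $(u,v),(v,u)$ is in $E$. The complementary digraph is $\overline{X}=(V,E^c)$, $(u,v)\in E^c$ iff $u\ne v$ and $(u,v)\notin E$. A $V$-listing is a bijection $\sigma:[n]\to V$; $\Sigma_V$ is the set of $V$-listings; $X\mathrm{Des}(\sigma)=\{1\le i\le n-1\mid(\sigma_i,\sigma_{i+1})\in E\}$. For $I\subset[n-1]$, $F_I=\sum x_{i_1}\cdots x_{i_n}$ over $1\le i_1\le\cdots\le i_n$ with $i_j<i_{j+1}$ for $j\in I$. The Redei-Berge symmetric function is $U_X=\sum_{\sigma\in\Sigma_V}F_{X\mathrm{Des}(\sigma)}$. The antipode $S$ of the Hopf algebra $QSym$ of quasisymmetric functions is given on fundamental quasisymmetric functions of degree $n$ by $S(F_I)=(-1)^nF_{(I^{\mathrm{op}})^c}$, where $I^{\mathrm{op}}=\{n-i\mid i\in I\}$ and $^c$ denotes complement in $[n-1]$. -}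

module Defs where

open import Data.Nat using (ℕ; zero; suc; pred)
open import Data.Integer using (ℤ; +_; -_; _*_)
open import Data.Bool using (Bool; true; false; not; _∧_; if_then_else_)
open import Data.Fin using (Fin)
import Data.Fin as Fin
open import Data.Vec using (Vec; []; _∷_; toList; reverse)
import Data.Vec as Vec
open import Data.Vec.Properties using (≡-dec)
open import Data.List using (List; []; _∷_; _++_; concatMap; allFin; filter; length; map; foldr)
import Data.List as List
open import Data.Product using (_×_)
open import Relation.Binary.PropositionalEquality using (_≡_; _≢_)
open import Relation.Nullary using (does)
import Relation.Nullary
import Data.Bool as Bool
import Data.List.Relation.Unary.Unique.DecPropositional as UDP

Digraph : ℕ → Set
Digraph n = Fin n → Fin n → Bool

IsTournament : ∀ {n} → Digraph n → Set
IsTournament {n} E =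
  (∀ (u : Fin n) → E u u ≡ false) ×
  (∀ (u v : Fin n) → u ≢ v → E u v ≡ not (E v u))

complement : ∀ {n} → Digraph n → Digraph n
complement E u v = not (does (u Fin.≟ v)) ∧ not (E u v)

allVecs : ∀ {A : Set} → List A → (m : ℕ) → List (Vec A m)
allVecs xs zero = [] ∷ []
allVecs xs (suc m) = concatMap (λ x → map (x ∷_) (allVecs xs m)) xs

-- V-listings: bijections [n] → V, represented as the sequence
-- (σ_1, …, σ_n) without repetitions (injective = bijective on Fin n).
listings : (n : ℕ) → List (Vec (Fin n) n)
listings n = filter (λ v → UDP.unique? (Fin._≟_ {n}) (toList v)) (allVecs (allFin n) n)

-- Subsets I of [k] represented as characteristic vectors: position j
-- (0-based) holds whether j+1 ∈ I.  Subsets of [n-1] : Vec Bool (pred n).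
SubsetOf : ℕ → Set
SubsetOf k = Vec Bool k

XDes : ∀ {n m} → Digraph n → Vec (Fin n) m → SubsetOf (pred m)
XDes E [] = []
XDes E (x ∷ []) = []
XDes E (x ∷ y ∷ r) = E x y ∷ XDes E (y ∷ r)

_≟S_ : ∀ {k} → (I J : SubsetOf k) → Relation.Nullary.Dec (I ≡ J)
_≟S_ = ≡-dec Bool._≟_

-- Homogeneous degree-n quasisymmetric functions, written in the basis of
-- fundamental quasisymmetric functions {F_I | I ⊆ [n-1]}: an element
-- Σ_I c_I F_I is stored as its coefficient function I ↦ c_I.
QSym : ℕ → Set
QSym n = SubsetOf (pred n) → ℤ

-- Redei–Berge symmetric function U_X = Σ_σ F_{XDes σ}: the coefficient of
-- F_I is the number of V-listings σ with XDes σ = I.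
U : ∀ {n} → Digraph n → QSym n
U {n} E I = + length (filter (λ σ → XDes E σ ≟S I) (listings n))

-- I^op = {n - i | i ∈ I} (reversal of the characteristic vector of a
-- subset of [n-1]); complement in [n-1].
op : ∀ {k} → SubsetOf k → SubsetOf k
op = reverse

compl : ∀ {k} → SubsetOf k → SubsetOf k
compl = Vec.map not

sign : ℕ → ℤ
sign zero = + 1
sign (suc n) = - sign n

sumℤ : List ℤ → ℤ
sumℤ = foldr Data.Integer._+_ (+ 0)

-- The antipode of QSym on degree n, extended linearly from
-- S(F_I) = (-1)^n F_{(I^op)^c}: coefficient of F_J in S(Σ c_I F_I) is
-- (-1)^n Σ_{I : (I^op)^c = J} c_I.
antipode : ∀ {n} → QSym n → QSym n
antipode {n} f J =
  sign n * sumℤ (map f (filter (λ I → compl (op I) ≟S J) (allVecs (true ∷ false ∷ []) (pred n))))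

_≈Q_ : ∀ {n} → QSym n → QSym n → Set
f ≈Q g = ∀ I → f I ≡ g I

_·Q_ : ∀ {n} → ℤ → QSym n → QSym n
(c ·Q f) I = c * f I

-- Write D_X(J) for the number of listings whose X-descent word is J, the coefficient of F_J in U_X.
-- Adjacent entries of a listing are distinct, so passing from X to its complement complements every
-- descent word, and for a tournament so does passing to the converse digraph; reversing a listing
-- turns its descent word for the converse into the reversed word.  Hence D_X̄(J) = D_X(J^c) = D_X(J^op),
-- and the coefficient (-1)^n D_X((J^c)^op) of S(U_X) at F_J is (-1)^n D_X(J).
-- What remains is D_X(J^op) = D_X(J) for an arbitrary digraph, proved for patterns with wildcards.
-- If a pattern demands edges at some positions and nothing elsewhere, a matching listing is a
-- concatenation of X-paths cut at the free positions, and putting these paths in reverse order is a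
-- bijection onto the listings matching the reversed pattern.  A position demanding a non-edge is
-- removed by induction: its count is the count with a wildcard there minus the count with an edge there.
module Submission where

open import Defs
open import Data.Bool using (Bool; true; false; not; _∧_; _∨_; T)
import Data.Bool as Bool
open import Data.Bool.ListAction using (and; all)
open import Data.Bool.Properties using (∧-assoc; ∧-comm; ∧-identityʳ; ∨-identityʳ; ∧-zeroʳ; T-∧; not-involutive)
open import Data.Empty using (⊥-elim)
open import Data.Fin using (Fin; _≟_)
open import Data.Integer using (+_; _*_)
import Data.Integer as ℤ
open import Data.Integer.Properties using (+-identityʳ)
open import Data.List
  using (List; []; _∷_; _++_; _∷ʳ_; map; filter; filterᵇ; length; reverse; replicate; concat; concatMap;
         intercalate; cartesianProductWith; allFin)
import Data.List.Properties as List
open import Data.List.Properties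
  using (length-map; length-replicate; map-∘; map-id; map-id-local; map-cong; map-++; map-replicate;
         filter-accept; filter-reject; filter-none; filter-≐; unfold-reverse; reverse-++; reverse-map;
         reverse-involutive; ++-assoc; ++-identityʳ; ∷ʳ-++; concat-++; ∷-injectiveˡ; ∷-injectiveʳ)
open import Data.List.Membership.Propositional using (_∈_)
open import Data.List.Membership.Propositional.Properties
  using (∈-map⁺; ∈-map⁻; ∈-filter⁺; ∈-filter⁻; ∈-allFin; ∈-cartesianProductWith⁺)
open import Data.List.Membership.Propositional.Properties.WithK using (unique∧set⇒bag)
open import Data.List.NonEmpty using (List⁺; _∷_; _∷⁺_; head; tail)
import Data.List.NonEmpty as List⁺
open import Data.List.Relation.Binary.BagAndSetEquality using (_∼[_]_; set; ∼bag⇒↭)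
open import Data.List.Relation.Binary.Permutation.Propositional
  using (_↭_; ↭-refl; ↭-sym; ↭⇒↭ₛ; module PermutationReasoning)
open import Data.List.Relation.Binary.Permutation.Propositional.Properties using (↭-length; ↭-reverse; ++-comm; ++⁺ˡ)
import Data.List.Relation.Binary.Permutation.Setoid.Properties as Permutationₛ
open import Data.List.Relation.Unary.All using ([]; _∷_)
import Data.List.Relation.Unary.All as All
open import Data.List.Relation.Unary.AllPairs using ([]; _∷_)
open import Data.List.Relation.Unary.Any using (here; there)
open import Data.List.Relation.Unary.Unique.Propositional using (Unique)
open import Data.List.Relation.Unary.Unique.Propositional.Properties
  using (map⁺; map⁻; filter⁺; allFin⁺; cartesianProductWith⁺)
import Data.List.Relation.Unary.Unique.DecPropositional as UniqueDec
open import Data.Maybe using (Maybe; just; nothing)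
open import Data.Nat using (ℕ; zero; suc; pred; _+_)
open import Data.Nat.Properties using (+-suc; suc-injective; +-cancelʳ-≡)
open import Data.Product using (_×_; _,_; proj₁; proj₂; ∃-syntax)
open import Data.Vec using (Vec; []; _∷_; toList; fromList; cast)
import Data.Vec.Properties as Vec
open import Function using (_∘_; mk⇔; Equivalence)
open import Level using (0ℓ)
open import Relation.Binary.Definitions using (DecidableEquality)
open import Relation.Binary.PropositionalEquality
open import Relation.Nullary using (does; yes; no)
open import Relation.Nullary.Decidable using (T?)
open import Relation.Unary using (Pred; Decidable)

module _ {A B : Set} {P : Pred A 0ℓ} {Q : Pred B 0ℓ} (P? : Decidable P) (Q? : Decidable Q) where

  length-filter-bijection : ∀ {xs ys} → Unique xs → Unique ys → (f : A → B) (g : B → A) →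
    (∀ {x} → x ∈ xs → P x → f x ∈ ys × Q (f x) × g (f x) ≡ x) →
    (∀ {y} → y ∈ ys → Q y → g y ∈ xs × P (g y) × f (g y) ≡ y) →
    length (filter P? xs) ≡ length (filter Q? ys)
  length-filter-bijection {xs} {ys} xs! ys! f g forth back = begin
    length (filter P? xs)          ≡⟨ length-map f (filter P? xs) ⟨
    length (map f (filter P? xs))  ≡⟨ ↭-length (∼bag⇒↭ (unique∧set⇒bag image! (filter⁺ Q? ys!) same-members)) ⟩
    length (filter Q? ys)          ∎
    where
    open ≡-Reasoning
    g∘f≡id : map g (map f (filter P? xs)) ≡ filter P? xs
    g∘f≡id = trans (sym (map-∘ (filter P? xs))) (map-id-local (All.tabulate λ x∈ →
      let x∈xs , px = ∈-filter⁻ P? x∈ in proj₂ (proj₂ (forth x∈xs px))))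
    image! : Unique (map f (filter P? xs))
    image! = map⁻ (subst Unique (sym g∘f≡id) (filter⁺ P? xs!))
    same-members : map f (filter P? xs) ∼[ set ] filter Q? ys
    same-members = mk⇔ to from
      where
      to : ∀ {y} → y ∈ map f (filter P? xs) → y ∈ filter Q? ys
      to y∈ with x , x∈ , refl ← ∈-map⁻ f y∈ =
        let x∈xs , px = ∈-filter⁻ P? x∈
            fx∈ys , qfx , _ = forth x∈xs px
        in ∈-filter⁺ Q? fx∈ys qfx
      from : ∀ {y} → y ∈ filter Q? ys → y ∈ map f (filter P? xs)
      from y∈ =
        let y∈ys , qy = ∈-filter⁻ Q? y∈
            gy∈xs , pgy , fgy≡y = back y∈ys qy
        in subst (_∈ map f (filter P? xs)) fgy≡y (∈-map⁺ f (∈-filter⁺ P? gy∈xs pgy))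

module _ {A : Set} where

  length-filterᵇ-partition : (r p q : A → Bool) → (∀ x → r x ≡ p x ∨ q x) → (∀ x → p x ∧ q x ≡ false) →
    ∀ xs → length (filterᵇ r xs) ≡ length (filterᵇ p xs) + length (filterᵇ q xs)
  length-filterᵇ-partition r p q r≡p∨q disjoint [] = refl
  length-filterᵇ-partition r p q r≡p∨q disjoint (x ∷ xs)
    rewrite r≡p∨q x with p x | q x | disjoint x | length-filterᵇ-partition r p q r≡p∨q disjoint xs
  ... | true  | true  | () | _
  ... | true  | false | _  | ih = cong suc ih
  ... | false | true  | _  | ih = trans (cong suc ih) (sym (+-suc _ _))
  ... | false | false | _  | ih = ih

  filter-map : ∀ {B : Set} (f : A → B) {P : Pred B 0ℓ} (P? : Decidable P) xs →
    filter P? (map f xs) ≡ map f (filter (P? ∘ f) xs)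
  filter-map f P? [] = refl
  filter-map f P? (x ∷ xs) with does (P? (f x))
  ... | true  = cong (f x ∷_) (filter-map f P? xs)
  ... | false = filter-map f P? xs

  filter-≟-unique : (_≟_ : DecidableEquality A) {x : A} {xs : List A} →
    Unique xs → x ∈ xs → filter (_≟ x) xs ≡ x ∷ []
  filter-≟-unique _≟_ {x} (x∉xs ∷ _) (here refl) =
    trans (filter-accept (_≟ x) refl) (cong (x ∷_) (filter-none (_≟ x) (All.map ≢-sym x∉xs)))
  filter-≟-unique _≟_ {x} (y∉xs ∷ xs!) (there x∈xs) =
    trans (filter-reject (_≟ x) (All.lookup y∉xs x∈xs)) (filter-≟-unique _≟_ xs! x∈xs)

  concatMap≡cartesianProductWith : ∀ {B C : Set} (f : A → B → C) xs ys →
    concatMap (λ x → map (f x) ys) xs ≡ cartesianProductWith f xs ys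
  concatMap≡cartesianProductWith f []       ys = refl
  concatMap≡cartesianProductWith f (x ∷ xs) ys = cong (map (f x) ys ++_) (concatMap≡cartesianProductWith f xs ys)

  reverse-++-∷ : ∀ (xs : List A) x ys → reverse (xs ++ x ∷ ys) ≡ reverse ys ++ x ∷ reverse xs
  reverse-++-∷ xs x ys = begin
    reverse (xs ++ x ∷ ys)             ≡⟨ reverse-++ xs (x ∷ ys) ⟩
    reverse (x ∷ ys) ++ reverse xs     ≡⟨ cong (_++ reverse xs) (unfold-reverse x ys) ⟩
    (reverse ys ∷ʳ x) ++ reverse xs    ≡⟨ ++-assoc (reverse ys) (x ∷ []) (reverse xs) ⟩
    reverse ys ++ x ∷ reverse xs       ∎
    where open ≡-Reasoning

  reverse-replicate : ∀ n (x : A) → reverse (replicate n x) ≡ replicate n x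
  reverse-replicate zero    x = refl
  reverse-replicate (suc n) x = begin
    reverse (x ∷ replicate n x)   ≡⟨ unfold-reverse x (replicate n x) ⟩
    reverse (replicate n x) ∷ʳ x  ≡⟨ cong (_∷ʳ x) (reverse-replicate n x) ⟩
    replicate n x ∷ʳ x            ≡⟨ replicate-∷ʳ n ⟩
    x ∷ replicate n x             ∎
    where
    open ≡-Reasoning
    replicate-∷ʳ : ∀ n → replicate n x ∷ʳ x ≡ x ∷ replicate n x
    replicate-∷ʳ zero    = refl
    replicate-∷ʳ (suc n) = cong (x ∷_) (replicate-∷ʳ n)

  concat-reverse : (xss : List (List A)) → concat (reverse xss) ↭ concat xss
  concat-reverse []         = ↭-refl
  concat-reverse (xs ∷ xss) = begin
    concat (reverse (xs ∷ xss))        ≡⟨ cong concat (unfold-reverse xs xss) ⟩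
    concat (reverse xss ∷ʳ xs)         ≡⟨ concat-++ (reverse xss) (xs ∷ []) ⟨
    concat (reverse xss) ++ xs ++ []   ≡⟨ cong (concat (reverse xss) ++_) (++-identityʳ xs) ⟩
    concat (reverse xss) ++ xs         ↭⟨ ++-comm (concat (reverse xss)) xs ⟩
    xs ++ concat (reverse xss)         ↭⟨ ++⁺ˡ xs (concat-reverse xss) ⟩
    xs ++ concat xss                   ∎
    where open PermutationReasoning

  all-reverse : (p : A → Bool) (xs : List A) → all p (reverse xs) ≡ all p xs
  all-reverse p []       = refl
  all-reverse p (x ∷ xs) = begin
    all p (reverse (x ∷ xs))           ≡⟨ cong (all p) (unfold-reverse x xs) ⟩
    all p (reverse xs ++ x ∷ [])       ≡⟨ all-++ (reverse xs) ⟩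
    all p (reverse xs) ∧ (p x ∧ true)  ≡⟨ cong₂ _∧_ (all-reverse p xs) (∧-identityʳ (p x)) ⟩
    all p xs ∧ p x                     ≡⟨ ∧-comm (all p xs) (p x) ⟩
    p x ∧ all p xs                     ∎
    where
    open ≡-Reasoning
    all-++ : ∀ xs {ys} → all p (xs ++ ys) ≡ all p xs ∧ all p ys
    all-++ []       = refl
    all-++ (x ∷ xs) = trans (cong (p x ∧_) (all-++ xs)) (sym (∧-assoc (p x) _ _))

  intercalate-∷ : ∀ (s : List A) x xs xss → intercalate s ((x ∷ xs) ∷ xss) ≡ x ∷ intercalate s (xs ∷ xss)
  intercalate-∷ s x xs []      = refl
  intercalate-∷ s x xs (_ ∷ _) = refl

  intercalate-∷ʳ : ∀ (s : List A) xss xs ys →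
    intercalate s (xss ∷ʳ xs ∷ʳ ys) ≡ intercalate s (xss ∷ʳ xs) ++ s ++ ys
  intercalate-∷ʳ s []         xs ys = refl
  intercalate-∷ʳ s (zs ∷ xss) xs ys = begin
    intercalate s (zs ∷ (xss ∷ʳ xs ∷ʳ ys))            ≡⟨ intercalate-∷-∷ʳ zs (xss ∷ʳ xs) ys ⟩
    zs ++ s ++ intercalate s (xss ∷ʳ xs ∷ʳ ys)        ≡⟨ cong (λ t → zs ++ s ++ t) (intercalate-∷ʳ s xss xs ys) ⟩
    zs ++ s ++ (intercalate s (xss ∷ʳ xs) ++ s ++ ys) ≡⟨ reassociate zs s (intercalate s (xss ∷ʳ xs)) (s ++ ys) ⟩
    (zs ++ s ++ intercalate s (xss ∷ʳ xs)) ++ s ++ ys ≡⟨ cong (_++ s ++ ys) (intercalate-∷-∷ʳ zs xss xs) ⟨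
    intercalate s (zs ∷ xss ∷ʳ xs) ++ s ++ ys         ∎
    where
    open ≡-Reasoning
    intercalate-∷-∷ʳ : ∀ zs xss xs → intercalate s (zs ∷ (xss ∷ʳ xs)) ≡ zs ++ s ++ intercalate s (xss ∷ʳ xs)
    intercalate-∷-∷ʳ zs []      xs = refl
    intercalate-∷-∷ʳ zs (_ ∷ _) xs = refl
    reassociate : ∀ (a b c d : List A) → a ++ b ++ c ++ d ≡ (a ++ b ++ c) ++ d
    reassociate a b c d = sym (trans (++-assoc a (b ++ c) d) (cong (a ++_) (++-assoc b c d)))

  reverse-intercalate : ∀ (s : List A) xss →
    reverse (intercalate s xss) ≡ intercalate (reverse s) (reverse (map reverse xss))
  reverse-intercalate s []              = refl
  reverse-intercalate s (xs ∷ [])       = refl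
  reverse-intercalate s (xs ∷ ys ∷ xss) = begin
    reverse (xs ++ s ++ intercalate s (ys ∷ xss))
      ≡⟨ reverse-++ xs _ ⟩
    reverse (s ++ intercalate s (ys ∷ xss)) ++ reverse xs
      ≡⟨ cong (_++ reverse xs) (reverse-++ s _) ⟩
    (reverse (intercalate s (ys ∷ xss)) ++ reverse s) ++ reverse xs
      ≡⟨ ++-assoc (reverse (intercalate s (ys ∷ xss))) (reverse s) (reverse xs) ⟩
    reverse (intercalate s (ys ∷ xss)) ++ reverse s ++ reverse xs
      ≡⟨ cong (_++ reverse s ++ reverse xs) (reverse-intercalate s (ys ∷ xss)) ⟩
    intercalate (reverse s) (reverse (map reverse (ys ∷ xss))) ++ reverse s ++ reverse xs
      ≡⟨ cong (λ t → intercalate (reverse s) t ++ reverse s ++ reverse xs)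
              (unfold-reverse (reverse ys) (map reverse xss)) ⟩
    intercalate (reverse s) (R ∷ʳ reverse ys) ++ reverse s ++ reverse xs
      ≡⟨ intercalate-∷ʳ (reverse s) R (reverse ys) (reverse xs) ⟨
    intercalate (reverse s) (R ∷ʳ reverse ys ∷ʳ reverse xs)
      ≡⟨ cong (λ t → intercalate (reverse s) (t ∷ʳ reverse xs)) (unfold-reverse (reverse ys) (map reverse xss)) ⟨
    intercalate (reverse s) (reverse (map reverse (ys ∷ xss)) ∷ʳ reverse xs)
      ≡⟨ cong (intercalate (reverse s)) (unfold-reverse (reverse xs) (map reverse (ys ∷ xss))) ⟨
    intercalate (reverse s) (reverse (map reverse (xs ∷ ys ∷ xss))) ∎
    where
    open ≡-Reasoning
    R : List (List A)
    R = reverse (map reverse xss)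

  toList-injective′ : ∀ {k} {u v : Vec A k} → toList u ≡ toList v → u ≡ v
  toList-injective′ {u = u} {v} eq = trans (sym (Vec.cast-is-id refl u)) (Vec.toList-injective refl u v eq)

map-not-involutive : ∀ (w : List Bool) → map not (map not w) ≡ w
map-not-involutive w = trans (sym (map-∘ w)) (trans (map-cong not-involutive w) (map-id w))

compl-involutive : ∀ {k} (I : SubsetOf k) → compl (compl I) ≡ I
compl-involutive I = trans (sym (Vec.map-∘ not not I)) (trans (Vec.map-cong not-involutive I) (Vec.map-id I))

-- Listings

module _ {A : Set} {xs : List A} where

  allVecs-unique : Unique xs → ∀ m → Unique (allVecs xs m)
  allVecs-unique xs! zero    = [] ∷ []
  allVecs-unique xs! (suc m) =
    subst Unique (sym (concatMap≡cartesianProductWith _∷_ xs (allVecs xs m)))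
      (cartesianProductWith⁺ _∷_ Vec.∷-injective xs! (allVecs-unique xs! m))

  ∈-allVecs : (∀ x → x ∈ xs) → ∀ {m} (v : Vec A m) → v ∈ allVecs xs m
  ∈-allVecs all∈ []              = here refl
  ∈-allVecs all∈ {suc m} (x ∷ v) =
    subst (x ∷ v ∈_) (sym (concatMap≡cartesianProductWith _∷_ xs (allVecs xs m)))
      (∈-cartesianProductWith⁺ _∷_ (all∈ x) (∈-allVecs all∈ v))

IsListing : ∀ {n} → List (Fin n) → Set
IsListing {n} l = length l ≡ n × Unique l

IsListing-↭ : ∀ {n} {l l′ : List (Fin n)} → l′ ↭ l → IsListing l → IsListing l′
IsListing-↭ {n} l′↭l (len , l!) =
  trans (↭-length l′↭l) len , Permutationₛ.Unique-resp-↭ (setoid (Fin n)) (↭⇒↭ₛ (↭-sym l′↭l)) l!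

listingLists : (n : ℕ) → List (List (Fin n))
listingLists n = map toList (listings n)

module _ {n : ℕ} where

  private
    unique? : Decidable (λ (σ : Vec (Fin n) n) → Unique (toList σ))
    unique? σ = UniqueDec.unique? _≟_ (toList σ)

  listingLists-unique : Unique (listingLists n)
  listingLists-unique = map⁺ toList-injective′ (filter⁺ unique? (allVecs-unique (allFin⁺ n) n))

  ∈-listingLists⁻ : ∀ {l} → l ∈ listingLists n → IsListing l
  ∈-listingLists⁻ l∈ with σ , σ∈ , refl ← ∈-map⁻ toList l∈ =
    Vec.length-toList σ , proj₂ (∈-filter⁻ unique? {xs = allVecs (allFin n) n} σ∈)

  ∈-listingLists⁺ : ∀ {l} → IsListing l → l ∈ listingLists n
  ∈-listingLists⁺ {l} (len , l!) =
    subst (_∈ listingLists n) toList-σ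
      (∈-map⁺ toList (∈-filter⁺ unique? (∈-allVecs ∈-allFin σ) (subst Unique (sym toList-σ) l!)))
    where
    σ : Vec (Fin n) n
    σ = cast len (fromList l)
    toList-σ : toList σ ≡ l
    toList-σ = trans (Vec.toList-cast len (fromList l)) (Vec.toList∘fromList l)

  #listings : {P : Pred (List (Fin n)) 0ℓ} → Decidable P → ℕ
  #listings P? = length (filter P? (listingLists n))

  #listings-bijection : {P Q : Pred (List (Fin n)) 0ℓ} (P? : Decidable P) (Q? : Decidable Q)
    (f g : List (Fin n) → List (Fin n)) → (∀ l → f l ↭ l) → (∀ l → g l ↭ l) →
    (∀ {l} → IsListing l → P l → Q (f l) × g (f l) ≡ l) →
    (∀ {l} → IsListing l → Q l → P (g l) × f (g l) ≡ l) →
    #listings P? ≡ #listings Q?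
  #listings-bijection P? Q? f g f↭ g↭ forth back =
    length-filter-bijection P? Q? listingLists-unique listingLists-unique f g
      (λ l∈ Pl → let L = ∈-listingLists⁻ l∈ in ∈-listingLists⁺ (IsListing-↭ (f↭ _) L) , forth L Pl)
      (λ l∈ Ql → let L = ∈-listingLists⁻ l∈ in ∈-listingLists⁺ (IsListing-↭ (g↭ _) L) , back L Ql)

-- Descent words

module _ {n : ℕ} where

  descents : Digraph n → List (Fin n) → List Bool
  descents E []          = []
  descents E (x ∷ [])    = []
  descents E (x ∷ y ∷ l) = E x y ∷ descents E (y ∷ l)

  converse : Digraph n → Digraph n
  converse E u v = E v u

  toList-XDes : ∀ {m} (E : Digraph n) (σ : Vec (Fin n) m) → toList (XDes E σ) ≡ descents E (toList σ)
  toList-XDes E []          = refl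
  toList-XDes E (x ∷ [])    = refl
  toList-XDes E (x ∷ y ∷ σ) = cong (E x y ∷_) (toList-XDes E (y ∷ σ))

  length-descents : ∀ (E : Digraph n) x l → length (descents E (x ∷ l)) ≡ length l
  length-descents E x []      = refl
  length-descents E x (y ∷ l) = cong suc (length-descents E y l)

  descents-++-∷ : ∀ (E : Digraph n) x b z w →
    ∃[ e ] descents E (x ∷ b ++ z ∷ w) ≡ descents E (x ∷ b) ++ e ∷ descents E (z ∷ w)
  descents-++-∷ E x []      z w = E x z , refl
  descents-++-∷ E x (y ∷ b) z w = let e , eq = descents-++-∷ E y b z w in e , cong (E x y ∷_) eq

  descents-∷ʳ : ∀ (E : Digraph n) l a b → descents E (l ∷ʳ a ∷ʳ b) ≡ descents E (l ∷ʳ a) ∷ʳ E a b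
  descents-∷ʳ E []          a b = refl
  descents-∷ʳ E (x ∷ [])    a b = refl
  descents-∷ʳ E (x ∷ y ∷ l) a b = cong (E x y ∷_) (descents-∷ʳ E (y ∷ l) a b)

  descents-reverse : ∀ (E : Digraph n) l → descents E (reverse l) ≡ reverse (descents (converse E) l)
  descents-reverse E []          = refl
  descents-reverse E (x ∷ [])    = refl
  descents-reverse E (x ∷ y ∷ l) = begin
    descents E (reverse (x ∷ y ∷ l))                  ≡⟨ cong (descents E) reverse-∷-∷ ⟩
    descents E (reverse l ∷ʳ y ∷ʳ x)                  ≡⟨ descents-∷ʳ E (reverse l) y x ⟩
    descents E (reverse l ∷ʳ y) ∷ʳ E y x              ≡⟨ cong (λ l′ → descents E l′ ∷ʳ E y x) (unfold-reverse y l) ⟨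
    descents E (reverse (y ∷ l)) ∷ʳ E y x             ≡⟨ cong (_∷ʳ E y x) (descents-reverse E (y ∷ l)) ⟩
    reverse (descents (converse E) (y ∷ l)) ∷ʳ E y x  ≡⟨ unfold-reverse (E y x) (descents (converse E) (y ∷ l)) ⟨
    reverse (descents (converse E) (x ∷ y ∷ l))       ∎
    where
    open ≡-Reasoning
    reverse-∷-∷ : reverse (x ∷ y ∷ l) ≡ reverse l ∷ʳ y ∷ʳ x
    reverse-∷-∷ = trans (unfold-reverse x (y ∷ l)) (cong (_∷ʳ x) (unfold-reverse y l))

  descents-not : ∀ {E E′ : Digraph n} → (∀ {x y} → x ≢ y → E′ x y ≡ not (E x y)) →
    ∀ {l} → Unique l → descents E′ l ≡ map not (descents E l)
  descents-not E′≡¬E {[]}        _                 = refl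
  descents-not E′≡¬E {x ∷ []}    _                 = refl
  descents-not E′≡¬E {x ∷ y ∷ l} ((x≢y ∷ _) ∷ yl!) = cong₂ _∷_ (E′≡¬E x≢y) (descents-not E′≡¬E yl!)

  complement-not : ∀ (E : Digraph n) {x y} → x ≢ y → complement E x y ≡ not (E x y)
  complement-not E {x} {y} x≢y with x ≟ y
  ... | yes x≡y = ⊥-elim (x≢y x≡y)
  ... | no  _   = refl

  converse-not : ∀ {E : Digraph n} → IsTournament E → ∀ {x y} → x ≢ y → converse E x y ≡ not (E x y)
  converse-not (_ , antisymmetric) x≢y = antisymmetric _ _ (≢-sym x≢y)

_≟ᴸ_ : DecidableEquality (List Bool)
_≟ᴸ_ = List.≡-dec Bool._≟_

#withDescents : ∀ {n} → Digraph n → List Bool → ℕ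
#withDescents E J = #listings (λ l → descents E l ≟ᴸ J)

module _ {n : ℕ} (E : Digraph n) where

  U-#withDescents : ∀ I → U E I ≡ + #withDescents E (toList I)
  U-#withDescents I = cong +_ (begin
    length (filter (λ σ → XDes E σ ≟S I) (listings n))
      ≡⟨ cong length (filter-≐ (λ σ → XDes E σ ≟S I) (λ σ → descents E (toList σ) ≟ᴸ toList I)
                               (to , from) (listings n)) ⟩
    length (filter (λ σ → descents E (toList σ) ≟ᴸ toList I) (listings n))
      ≡⟨ length-map toList (filter (λ σ → descents E (toList σ) ≟ᴸ toList I) (listings n)) ⟨
    length (map toList (filter (λ σ → descents E (toList σ) ≟ᴸ toList I) (listings n)))
      ≡⟨ cong length (filter-map toList (λ l → descents E l ≟ᴸ toList I) (listings n)) ⟨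
    #withDescents E (toList I) ∎)
    where
    open ≡-Reasoning
    to : ∀ {σ} → XDes E σ ≡ I → descents E (toList σ) ≡ toList I
    to {σ} eq = trans (sym (toList-XDes E σ)) (cong toList eq)
    from : ∀ {σ} → descents E (toList σ) ≡ toList I → XDes E σ ≡ I
    from {σ} eq = toList-injective′ (trans (toList-XDes E σ) eq)

  #withDescents-converse : ∀ J → #withDescents (converse E) J ≡ #withDescents E (reverse J)
  #withDescents-converse J = #listings-bijection _ _ reverse reverse ↭-reverse ↭-reverse
    (λ {l} _ eq → trans (descents-reverse E l) (cong reverse eq) , reverse-involutive l)
    (λ {l} _ eq → trans (descents-reverse (converse E) l) (trans (cong reverse eq) (reverse-involutive J)) ,
                  reverse-involutive l)

  #withDescents-not : ∀ {E′ : Digraph n} → (∀ {x y} → x ≢ y → E′ x y ≡ not (E x y)) →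
    ∀ J → #withDescents E′ J ≡ #withDescents E (map not J)
  #withDescents-not E′≡¬E J = #listings-bijection _ _ (λ l → l) (λ l → l) (λ _ → ↭-refl) (λ _ → ↭-refl)
    (λ {l} (_ , l!) eq → trans (sym (map-not-involutive (descents E l)))
                               (cong (map not) (trans (sym (descents-not E′≡¬E l!)) eq)) , refl)
    (λ {l} (_ , l!) eq → trans (descents-not E′≡¬E l!) (trans (cong (map not) eq) (map-not-involutive J)) , refl)

-- Patterns

Pattern : Set
Pattern = List (Maybe Bool)

matches : Pattern → List Bool → Bool
matches []            []      = true
matches (nothing ∷ P) (_ ∷ w) = matches P w
matches (just c ∷ P)  (b ∷ w) = does (b Bool.≟ c) ∧ matches P w
matches _             _       = false

forced : Bool → Maybe Bool
forced true  = just true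
forced false = nothing

matches-exact⁺ : ∀ J → T (matches (map just J) J)
matches-exact⁺ []          = _
matches-exact⁺ (true ∷ J)  = matches-exact⁺ J
matches-exact⁺ (false ∷ J) = matches-exact⁺ J

matches-exact⁻ : ∀ J w → T (matches (map just J) w) → w ≡ J
matches-exact⁻ []      []      _ = refl
matches-exact⁻ (c ∷ J) (b ∷ w) m =
  let b≡c , m′ = Equivalence.to T-∧ m in cong₂ _∷_ (T-does-≟ b c b≡c) (matches-exact⁻ J w m′)
  where
  T-does-≟ : ∀ b c → T (does (b Bool.≟ c)) → b ≡ c
  T-does-≟ true  true  _ = refl
  T-does-≟ false false _ = refl

matches-length : ∀ P w → T (matches P w) → length P ≡ length w
matches-length []            []      _ = refl
matches-length (nothing ∷ P) (_ ∷ w) m = cong suc (matches-length P w m)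
matches-length (just c ∷ P)  (b ∷ w) m = cong suc (matches-length P w (proj₂ (Equivalence.to T-∧ m)))

matches-++ : ∀ P u Q w → length P ≡ length u → matches (P ++ Q) (u ++ w) ≡ matches P u ∧ matches Q w
matches-++ []            []      Q w _   = refl
matches-++ (nothing ∷ P) (_ ∷ u) Q w len = matches-++ P u Q w (suc-injective len)
matches-++ (just c ∷ P)  (b ∷ u) Q w len =
  trans (cong (does (b Bool.≟ c) ∧_) (matches-++ P u Q w (suc-injective len)))
        (sym (∧-assoc (does (b Bool.≟ c)) (matches P u) (matches Q w)))

matches-all-true : ∀ k w → length w ≡ k → matches (replicate k (just true)) w ≡ and w
matches-all-true zero    []          _   = refl
matches-all-true (suc k) (true ∷ w)  len = matches-all-true k w (suc-injective len)
matches-all-true (suc k) (false ∷ w) len = refl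

matches-wildcard : ∀ P Q w →
  matches (P ++ nothing ∷ Q) w ≡ matches (P ++ just false ∷ Q) w ∨ matches (P ++ just true ∷ Q) w
matches-wildcard []            Q []          = refl
matches-wildcard []            Q (true ∷ w)  = refl
matches-wildcard []            Q (false ∷ w) = sym (∨-identityʳ _)
matches-wildcard (nothing ∷ P) Q []          = refl
matches-wildcard (just _ ∷ P)  Q []          = refl
matches-wildcard (nothing ∷ P) Q (b ∷ w)     = matches-wildcard P Q w
matches-wildcard (just c ∷ P)  Q (b ∷ w) with does (b Bool.≟ c)
... | true  = matches-wildcard P Q w
... | false = refl

matches-false-true : ∀ P Q w → matches (P ++ just false ∷ Q) w ∧ matches (P ++ just true ∷ Q) w ≡ false
matches-false-true []            Q []          = refl
matches-false-true []            Q (true ∷ w)  = refl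
matches-false-true []            Q (false ∷ w) = ∧-zeroʳ _
matches-false-true (nothing ∷ P) Q []          = refl
matches-false-true (just _ ∷ P)  Q []          = refl
matches-false-true (nothing ∷ P) Q (b ∷ w)     = matches-false-true P Q w
matches-false-true (just c ∷ P)  Q (b ∷ w) with does (b Bool.≟ c)
... | true  = matches-false-true P Q w
... | false = refl

-- Block decompositions

module _ {A : Set} where

  flat : List (List⁺ A) → List A
  flat = concatMap List⁺.toList

  interior : List⁺ A → List Bool
  interior c = replicate (length (tail c)) true

  shape : List (List⁺ A) → List Bool
  shape cs = intercalate (false ∷ []) (map interior cs)

  prependToFirst : A → List⁺ (List⁺ A) → List⁺ (List⁺ A)
  prependToFirst x (c ∷ cs) = (x ∷⁺ c) ∷ cs

  chop : List Bool → A → List A → List⁺ (List⁺ A)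
  chop (true ∷ Q)  x (y ∷ ys) = prependToFirst x (chop Q y ys)
  chop (false ∷ Q) x (y ∷ ys) = (x ∷ []) ∷⁺ chop Q y ys
  chop _           x ys       = (x ∷ ys) ∷ []

  blocks : List Bool → List A → List (List⁺ A)
  blocks Q []       = []
  blocks Q (x ∷ ys) = List⁺.toList (chop Q x ys)

  reverseBlocks : List Bool → List A → List A
  reverseBlocks Q l = flat (reverse (blocks Q l))

  flat-blocks : ∀ Q l → flat (blocks Q l) ≡ l
  flat-blocks Q []       = refl
  flat-blocks Q (x ∷ ys) = flat-chop Q x ys
    where
    flat-chop : ∀ Q x ys → flat (List⁺.toList (chop Q x ys)) ≡ x ∷ ys
    flat-chop []          x ys       = cong (x ∷_) (++-identityʳ ys)
    flat-chop (true ∷ _)  x []       = refl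
    flat-chop (false ∷ _) x []       = refl
    flat-chop (true ∷ Q)  x (y ∷ ys) = cong (x ∷_) (flat-chop Q y ys)
    flat-chop (false ∷ Q) x (y ∷ ys) = cong (x ∷_) (flat-chop Q y ys)

  shape-blocks : ∀ Q x ys → length Q ≡ length ys → shape (blocks Q (x ∷ ys)) ≡ Q
  shape-blocks []          x []       _   = refl
  shape-blocks (true ∷ Q)  x (y ∷ ys) len =
    trans (intercalate-∷ (false ∷ []) true (interior (head (chop Q y ys))) (map interior (tail (chop Q y ys))))
          (cong (true ∷_) (shape-blocks Q y ys (suc-injective len)))
  shape-blocks (false ∷ Q) x (y ∷ ys) len = cong (false ∷_) (shape-blocks Q y ys (suc-injective len))

  blocks-shape : ∀ cs → blocks (shape cs) (flat cs) ≡ cs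
  blocks-shape []             = refl
  blocks-shape ((x ∷ b) ∷ cs) = chop-shape x b cs
    where
    chop-shape : ∀ x b cs → List⁺.toList (chop (shape ((x ∷ b) ∷ cs)) x (b ++ flat cs)) ≡ (x ∷ b) ∷ cs
    chop-shape x []      []             = refl
    chop-shape x []      ((z ∷ c) ∷ cs) = cong ((x ∷ []) ∷_) (chop-shape z c cs)
    chop-shape x (y ∷ b) cs             =
      let ih = chop-shape y b cs in
      trans (cong (λ Q → List⁺.toList (chop Q x (y ∷ b ++ flat cs)))
                  (intercalate-∷ (false ∷ []) true (interior (y ∷ b)) (map interior cs)))
            (cong₂ (λ c cs → (x ∷⁺ c) ∷ cs) (∷-injectiveˡ ih) (∷-injectiveʳ ih))

  shape-reverse : ∀ cs → shape (reverse cs) ≡ reverse (shape cs)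
  shape-reverse cs = begin
    intercalate (false ∷ []) (map interior (reverse cs))
      ≡⟨ cong (intercalate _) (reverse-map interior cs) ⟩
    intercalate (false ∷ []) (reverse (map interior cs))
      ≡⟨ cong (intercalate _ ∘ reverse) palindromes ⟨
    intercalate (false ∷ []) (reverse (map reverse (map interior cs)))
      ≡⟨ reverse-intercalate (false ∷ []) (map interior cs) ⟨
    reverse (shape cs) ∎
    where
    open ≡-Reasoning
    palindromes : map reverse (map interior cs) ≡ map interior cs
    palindromes = trans (sym (map-∘ cs)) (map-cong (λ c → reverse-replicate (length (tail c)) true) cs)

  reverseBlocks-↭ : ∀ Q l → reverseBlocks Q l ↭ l
  reverseBlocks-↭ Q l = begin
    flat (reverse (blocks Q l))               ≡⟨ cong concat (reverse-map List⁺.toList (blocks Q l)) ⟩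
    concat (reverse (map List⁺.toList (blocks Q l))) ↭⟨ concat-reverse (map List⁺.toList (blocks Q l)) ⟩
    flat (blocks Q l)                         ≡⟨ flat-blocks Q l ⟩
    l                                         ∎
    where open PermutationReasoning

  reverseBlocks-involutive : ∀ Q l → reverseBlocks (shape (reverse (blocks Q l))) (reverseBlocks Q l) ≡ l
  reverseBlocks-involutive Q l = begin
    flat (reverse (blocks (shape (reverse cs)) (flat (reverse cs))))
      ≡⟨ cong (flat ∘ reverse) (blocks-shape (reverse cs)) ⟩
    flat (reverse (reverse cs))
      ≡⟨ cong flat (reverse-involutive cs) ⟩
    flat cs
      ≡⟨ flat-blocks Q l ⟩
    l ∎
    where
    open ≡-Reasoning
    cs : List (List⁺ A)
    cs = blocks Q l

-- Reversal symmetry of descent counts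

module _ {n : ℕ} (E : Digraph n) where

  #matching : Pattern → ℕ
  #matching P = #listings (λ l → T? (matches P (descents E l)))

  #matching-exact : ∀ J → #matching (map just J) ≡ #withDescents E J
  #matching-exact J =
    cong length (filter-≐ (λ l → T? (matches (map just J) (descents E l))) (λ l → descents E l ≟ᴸ J)
                          (matches-exact⁻ J _ , λ { refl → matches-exact⁺ J }) (listingLists n))

  #matching-wildcard : ∀ P Q →
    #matching (P ++ nothing ∷ Q) ≡ #matching (P ++ just false ∷ Q) + #matching (P ++ just true ∷ Q)
  #matching-wildcard P Q = length-filterᵇ-partition _ _ _
    (λ l → matches-wildcard P Q (descents E l)) (λ l → matches-false-true P Q (descents E l)) (listingLists n)

  isPath : List⁺ (Fin n) → Bool
  isPath c = and (descents E (List⁺.toList c))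

  matches-forced-interior : ∀ c → matches (map forced (interior c)) (descents E (List⁺.toList c)) ≡ isPath c
  matches-forced-interior (x ∷ b) =
    trans (cong (λ P → matches P (descents E (x ∷ b))) (map-replicate forced (length b) true))
          (matches-all-true (length b) _ (length-descents E x b))

  matches-forced-shape : ∀ cs → matches (map forced (shape cs)) (descents E (flat cs)) ≡ all isPath cs
  matches-forced-shape []                         = refl
  matches-forced-shape ((x ∷ b) ∷ [])             = begin
    matches (map forced (interior (x ∷ b))) (descents E (x ∷ b ++ []))
      ≡⟨ cong (λ l → matches (map forced (interior (x ∷ b))) (descents E (x ∷ l))) (++-identityʳ b) ⟩
    matches (map forced (interior (x ∷ b))) (descents E (x ∷ b))
      ≡⟨ matches-forced-interior (x ∷ b) ⟩
    isPath (x ∷ b)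
      ≡⟨ ∧-identityʳ _ ⟨
    isPath (x ∷ b) ∧ true ∎
    where open ≡-Reasoning
  matches-forced-shape ((x ∷ b) ∷ (z ∷ c) ∷ cs) = begin
    matches (map forced (interior (x ∷ b) ++ false ∷ shape ((z ∷ c) ∷ cs))) (descents E (x ∷ b ++ z ∷ c ++ flat cs))
      ≡⟨ cong₂ matches (map-++ forced (interior (x ∷ b)) _) (proj₂ split) ⟩
    matches (map forced (interior (x ∷ b)) ++ nothing ∷ map forced (shape ((z ∷ c) ∷ cs)))
            (descents E (x ∷ b) ++ proj₁ split ∷ descents E (z ∷ c ++ flat cs))
      ≡⟨ matches-++ (map forced (interior (x ∷ b))) (descents E (x ∷ b)) _ _ same-length ⟩
    matches (map forced (interior (x ∷ b))) (descents E (x ∷ b)) ∧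
    matches (map forced (shape ((z ∷ c) ∷ cs))) (descents E (flat ((z ∷ c) ∷ cs)))
      ≡⟨ cong₂ _∧_ (matches-forced-interior (x ∷ b)) (matches-forced-shape ((z ∷ c) ∷ cs)) ⟩
    all isPath ((x ∷ b) ∷ (z ∷ c) ∷ cs) ∎
    where
    open ≡-Reasoning
    split : ∃[ e ] descents E (x ∷ b ++ z ∷ c ++ flat cs) ≡ descents E (x ∷ b) ++ e ∷ descents E (z ∷ c ++ flat cs)
    split = descents-++-∷ E x b z (c ++ flat cs)
    same-length : length (map forced (interior (x ∷ b))) ≡ length (descents E (x ∷ b))
    same-length = trans (length-map forced (interior (x ∷ b)))
                        (trans (length-replicate (length b)) (sym (length-descents E x b)))

  shape-blocks-matching : ∀ Q l → T (matches (map forced Q) (descents E l)) → shape (blocks Q l) ≡ Q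
  shape-blocks-matching []          []       _ = refl
  shape-blocks-matching (true ∷ Q)  []       ()
  shape-blocks-matching (false ∷ Q) []       ()
  shape-blocks-matching Q           (x ∷ ys) m = shape-blocks Q x ys (begin
    length Q                      ≡⟨ length-map forced Q ⟨
    length (map forced Q)         ≡⟨ matches-length (map forced Q) (descents E (x ∷ ys)) m ⟩
    length (descents E (x ∷ ys))  ≡⟨ length-descents E x ys ⟩
    length ys                     ∎)
    where open ≡-Reasoning

  reverseBlocks-matches : ∀ {Q Q′} l → reverse Q ≡ Q′ → T (matches (map forced Q) (descents E l)) →
    T (matches (map forced Q′) (descents E (reverseBlocks Q l))) × reverseBlocks Q′ (reverseBlocks Q l) ≡ l
  reverseBlocks-matches {Q} l refl m =
    subst T matching m ,
    subst (λ Q′ → reverseBlocks Q′ (reverseBlocks Q l) ≡ l) reversed-shape (reverseBlocks-involutive Q l)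
    where
    open ≡-Reasoning
    cs : List (List⁺ (Fin n))
    cs = blocks Q l
    shape≡Q : shape cs ≡ Q
    shape≡Q = shape-blocks-matching Q l m
    reversed-shape : shape (reverse cs) ≡ reverse Q
    reversed-shape = trans (shape-reverse cs) (cong reverse shape≡Q)
    matching : matches (map forced Q) (descents E l) ≡ matches (map forced (reverse Q)) (descents E (flat (reverse cs)))
    matching = begin
      matches (map forced Q) (descents E l)
        ≡⟨ cong₂ (λ P l → matches (map forced P) (descents E l)) shape≡Q (flat-blocks Q l) ⟨
      matches (map forced (shape cs)) (descents E (flat cs))
        ≡⟨ matches-forced-shape cs ⟩
      all isPath cs
        ≡⟨ all-reverse isPath cs ⟨
      all isPath (reverse cs)
        ≡⟨ matches-forced-shape (reverse cs) ⟨
      matches (map forced (shape (reverse cs))) (descents E (flat (reverse cs)))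
        ≡⟨ cong (λ P → matches (map forced P) (descents E (flat (reverse cs)))) reversed-shape ⟩
      matches (map forced (reverse Q)) (descents E (flat (reverse cs))) ∎

  #matching-reverse-forced : ∀ Q → #matching (map forced Q) ≡ #matching (map forced (reverse Q))
  #matching-reverse-forced Q =
    #listings-bijection _ _ (reverseBlocks Q) (reverseBlocks (reverse Q)) (reverseBlocks-↭ Q) (reverseBlocks-↭ (reverse Q))
      (λ {l} _ → reverseBlocks-matches l refl)
      (λ {l} _ → reverseBlocks-matches l (reverse-involutive Q))

  ReversalInvariant : Pattern → Set
  ReversalInvariant P = #matching (reverse P) ≡ #matching P

  reversalInvariant-shift : ∀ Q b P →
    ReversalInvariant (map forced (Q ∷ʳ b) ++ P) → ReversalInvariant (map forced Q ++ forced b ∷ P)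
  reversalInvariant-shift Q b P =
    subst ReversalInvariant (trans (cong (_++ P) (map-++ forced Q (b ∷ []))) (∷ʳ-++ (map forced Q) (forced b) P))

  reversalInvariant-suffix : ∀ Q P → ReversalInvariant (map forced Q ++ P)
  reversalInvariant-suffix Q [] =
    subst ReversalInvariant (sym (++-identityʳ (map forced Q)))
      (trans (cong #matching (sym (reverse-map forced Q))) (sym (#matching-reverse-forced Q)))
  reversalInvariant-suffix Q (nothing ∷ P)    = reversalInvariant-shift Q false P (reversalInvariant-suffix (Q ∷ʳ false) P)
  reversalInvariant-suffix Q (just true ∷ P)  = reversalInvariant-shift Q true P (reversalInvariant-suffix (Q ∷ʳ true) P)
  reversalInvariant-suffix Q (just false ∷ P) = +-cancelʳ-≡ (#matching (A ++ just true ∷ P)) _ _ (begin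
    #matching (reverse (A ++ just false ∷ P)) + #matching (A ++ just true ∷ P)
      ≡⟨ cong₂ _+_ refl with-true ⟨
    #matching (reverse (A ++ just false ∷ P)) + #matching (reverse (A ++ just true ∷ P))
      ≡⟨ cong₂ _+_ (cong #matching (reverse-++-∷ A _ P)) (cong #matching (reverse-++-∷ A _ P)) ⟩
    #matching (reverse P ++ just false ∷ reverse A) + #matching (reverse P ++ just true ∷ reverse A)
      ≡⟨ #matching-wildcard (reverse P) (reverse A) ⟨
    #matching (reverse P ++ nothing ∷ reverse A)
      ≡⟨ cong #matching (reverse-++-∷ A nothing P) ⟨
    #matching (reverse (A ++ nothing ∷ P))
      ≡⟨ with-wildcard ⟩
    #matching (A ++ nothing ∷ P)
      ≡⟨ #matching-wildcard A P ⟩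
    #matching (A ++ just false ∷ P) + #matching (A ++ just true ∷ P) ∎)
    where
    open ≡-Reasoning
    A : Pattern
    A = map forced Q
    with-wildcard : ReversalInvariant (A ++ nothing ∷ P)
    with-wildcard = reversalInvariant-shift Q false P (reversalInvariant-suffix (Q ∷ʳ false) P)
    with-true : ReversalInvariant (A ++ just true ∷ P)
    with-true = reversalInvariant-shift Q true P (reversalInvariant-suffix (Q ∷ʳ true) P)

  #withDescents-reverse : ∀ J → #withDescents E (reverse J) ≡ #withDescents E J
  #withDescents-reverse J = begin
    #withDescents E (reverse J)      ≡⟨ #matching-exact (reverse J) ⟨
    #matching (map just (reverse J)) ≡⟨ cong #matching (reverse-map just J) ⟩
    #matching (reverse (map just J)) ≡⟨ reversalInvariant-suffix [] (map just J) ⟩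
    #matching (map just J)           ≡⟨ #matching-exact J ⟩
    #withDescents E J                ∎
    where open ≡-Reasoning

-- The antipode

antipode-coefficient : ∀ {n} (f : QSym n) J → antipode {n} f J ≡ sign n * f (op (compl J))
antipode-coefficient {n} f J = cong (sign n *_) (begin
  sumℤ (map f (filter (λ I → compl (op I) ≟S J) subsets)) ≡⟨ cong (sumℤ ∘ map f) selected ⟩
  f I₀ ℤ.+ + 0                                            ≡⟨ +-identityʳ (f I₀) ⟩
  f I₀                                                    ∎)
  where
  open ≡-Reasoning
  bits : List Bool
  bits = true ∷ false ∷ []
  bits-unique : Unique bits
  bits-unique = ((λ ()) ∷ []) ∷ [] ∷ []
  bits-complete : ∀ b → b ∈ bits
  bits-complete true  = here refl
  bits-complete false = there (here refl)
  subsets : List (SubsetOf (pred n))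
  subsets = allVecs bits (pred n)
  I₀ : SubsetOf (pred n)
  I₀ = op (compl J)
  to : ∀ {I} → compl (op I) ≡ J → I ≡ I₀
  to {I} eq = trans (sym (trans (cong op (compl-involutive (op I))) (Vec.reverse-involutive I))) (cong (op ∘ compl) eq)
  from : ∀ {I} → I ≡ I₀ → compl (op I) ≡ J
  from refl = trans (cong compl (Vec.reverse-involutive (compl J))) (compl-involutive J)
  selected : filter (λ I → compl (op I) ≟S J) subsets ≡ I₀ ∷ []
  selected = trans (filter-≐ (λ I → compl (op I) ≟S J) (_≟S I₀) (to , from) subsets)
                   (filter-≟-unique _≟S_ (allVecs-unique bits-unique (pred n)) (∈-allVecs bits-complete I₀))

module _ {n : ℕ} {X : Digraph n} (tournament : IsTournament X) where

  U-complement : ∀ I → U (complement X) I ≡ U X I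
  U-complement I = begin
    U (complement X) I                          ≡⟨ U-#withDescents (complement X) I ⟩
    + #withDescents (complement X) (toList I)   ≡⟨ cong +_ (#withDescents-not X (complement-not X) (toList I)) ⟩
    + #withDescents X (map not (toList I))      ≡⟨ cong +_ (#withDescents-not X (converse-not tournament) (toList I)) ⟨
    + #withDescents (converse X) (toList I)     ≡⟨ cong +_ (#withDescents-converse X (toList I)) ⟩
    + #withDescents X (reverse (toList I))      ≡⟨ cong +_ (#withDescents-reverse X (toList I)) ⟩
    + #withDescents X (toList I)                ≡⟨ U-#withDescents X I ⟨
    U X I                                       ∎
    where open ≡-Reasoning

  U-op-compl : ∀ J → U X (op (compl J)) ≡ U X J
  U-op-compl J = begin
    U X (op (compl J))                                ≡⟨ U-#withDescents X (op (compl J)) ⟩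
    + #withDescents X (toList (op (compl J)))         ≡⟨ cong (+_ ∘ #withDescents X) toList-op-compl ⟩
    + #withDescents X (reverse (map not (toList J)))  ≡⟨ cong +_ (#withDescents-converse X (map not (toList J))) ⟨
    + #withDescents (converse X) (map not (toList J)) ≡⟨ cong +_ (#withDescents-not X (converse-not tournament) _) ⟩
    + #withDescents X (map not (map not (toList J)))  ≡⟨ cong (+_ ∘ #withDescents X) (map-not-involutive (toList J)) ⟩
    + #withDescents X (toList J)                      ≡⟨ U-#withDescents X J ⟨
    U X J                                             ∎
    where
    open ≡-Reasoning
    toList-op-compl : toList (op (compl J)) ≡ reverse (map not (toList J))
    toList-op-compl = trans (Vec.toList-reverse (compl J)) (cong reverse (Vec.toList-map not J))

mainTheorem10 : (n : ℕ) (X : Digraph n) → IsTournament X →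
    (_≈Q_ {n} (U X) (U (complement X))) ×
    (_≈Q_ {n} (antipode {n} (U X)) (_·Q_ {n} (sign n) (U X)))
mainTheorem10 n X tournament =
  (λ I → sym (U-complement tournament I)) ,
  (λ J → trans (antipode-coefficient {n} (U X) J) (cong (sign n *_) (U-op-compl tournament J)))
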